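{- Let $n\ge2$, let $c$ be a minimal-cellular cubic coordinate of size $n$ and let $i\in[n-1]$. If $c'=\uparrow_{i+1}(\uparrow_{i+2}(\cdots(\uparrow_{n-1}(c))\cdots))$ is well defined (with $c'=c$ when $i=n-1$), then $\uparrow_i(c')$ is well defined.
   Context: Tamari diagram of size $n$: a word $u=u_1\cdots u_n$ of integers with $0\le u_i\le n-i$ and $u_{i+j}\le u_i-j$ for all $i\in[n]$, $0\le j\le u_i$. Dual Tamari diagram of size $n$: a word $v=v_1\cdots v_n$ of integers with $0\le v_i\le i-1$ and $v_{i-j}\le v_i-j$ for all $i\in[n]$, $0\le j\le v_i$. A pair $(u,v)$ of these is a Tamari interval diagram if for all $1\le i<j\le n$ with $j-i\le u_i$ one has $v_j<j-i$. An $(n-1)$-tuple $c$ of integers is a cubic coordinate of size $n$ if the pair $(u,v)$ with $u_i=\max(c_i,0)$ ($i\in[n-1]$), $u_n=0$, $v_1=0$, $v_i=|\min(c_{i-1},0)|$ ($2\le i\le n$) is a Tamari interval diagram; $\mathcal{CC}_n$ is their set, ordered componentwise by $\leq_{\mathrm{cc}}$ with covering relation $\lessdot$. For $c\in\mathcal{CC}_n$ and $i\in[n-1]$, the minimal increase $\uparrow_i(c)$ is defined (well defined) when there exists $c'\in\mathcal{CC}_n$ with $c'_i>c_i$ and $c'_j=c_j$ for $j\ne i$; then $\uparrow_i(c)$ equals $c$ except that its $i$-th entry is the smallest integer $\widehat c_i>c_i$ for which the resulting tuple lies in $\mathcal{CC}_n$ (so $c\lessdot\uparrow_i(c)$). A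 cubic coordinate $c$ is minimal-cellular if $\uparrow_i(c)$ is defined for every $i\in[n-1]$. -}

module Defs where

open import Data.Nat using (ℕ; zero; suc; _≤_; _<_; _∸_; _+_)
open import Data.Integer as ℤ using (ℤ; _⊔_; _⊓_; ∣_∣; 0ℤ)
open import Data.Vec using (Vec; []; _∷_)
open import Data.Product using (Σ; _×_)
open import Relation.Binary.PropositionalEquality using (_≡_)
open import Relation.Nullary using (¬_)

-- Words are modelled as functions ℕ → ℕ; only indices 1..n are constrained.

IsTamariDiagram : ℕ → (ℕ → ℕ) → Set
IsTamariDiagram n u =
  ∀ i → 1 ≤ i → i ≤ n →
    (u i ≤ n ∸ i) × (∀ j → j ≤ u i → u (i + j) ≤ u i ∸ j)

IsDualTamariDiagram : ℕ → (ℕ → ℕ) → Set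
IsDualTamariDiagram n v =
  ∀ i → 1 ≤ i → i ≤ n →
    (v i ≤ i ∸ 1) × (∀ j → j ≤ v i → v (i ∸ j) ≤ v i ∸ j)

IsTID : ℕ → (ℕ → ℕ) → (ℕ → ℕ) → Set
IsTID n u v =
  IsTamariDiagram n u × IsDualTamariDiagram n v ×
  (∀ i j → 1 ≤ i → i < j → j ≤ n → j ∸ i ≤ u i → v j < j ∸ i)

-- 1-indexed access to a tuple (c_1, ..., c_m); 0 outside [m] (never used there)
at : ∀ {m} → Vec ℤ m → ℕ → ℤ
at [] _ = 0ℤ
at (x ∷ xs) zero = 0ℤ
at (x ∷ xs) (suc zero) = x
at (x ∷ xs) (suc (suc k)) = at xs (suc k)

-- 1-indexed update: replace c_i by z (no change if i ∉ [m])
set : ∀ {m} → Vec ℤ m → ℕ → ℤ → Vec ℤ m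
set [] _ _ = []
set (x ∷ xs) zero z = x ∷ xs
set (x ∷ xs) (suc zero) z = z ∷ xs
set (x ∷ xs) (suc (suc k)) z = x ∷ set xs (suc k) z

uOf : ∀ n → Vec ℤ (n ∸ 1) → ℕ → ℕ
uOf n c i = ∣ at c i ⊔ 0ℤ ∣
-- u_i = max(c_i,0) for i ∈ [n-1]; at c n = 0ℤ (index outside [n-1]) gives u_n = 0

vOf : ∀ n → Vec ℤ (n ∸ 1) → ℕ → ℕ
vOf n c zero = 0
vOf n c (suc zero) = 0
vOf n c (suc (suc k)) = ∣ at c (suc k) ⊓ 0ℤ ∣

IsCC : ∀ n → Vec ℤ (n ∸ 1) → Set
IsCC n c = IsTID n (uOf n c) (vOf n c)

UpDefined : ∀ n → ℕ → Vec ℤ (n ∸ 1) → Set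
UpDefined n i c = Σ ℤ λ z → (at c i ℤ.< z) × IsCC n (set c i z)

MinInc : ∀ n → ℕ → Vec ℤ (n ∸ 1) → Vec ℤ (n ∸ 1) → Set
MinInc n i c e = Σ ℤ λ z →
  (at c i ℤ.< z) × IsCC n (set c i z) ×
  (∀ w → at c i ℤ.< w → w ℤ.< z → ¬ IsCC n (set c i w)) ×
  (e ≡ set c i z)

IsMinCellular : ∀ n → Vec ℤ (n ∸ 1) → Set
IsMinCellular n c = ∀ i → 1 ≤ i → i ≤ n ∸ 1 → UpDefined n i c

data Chain (n : ℕ) (c : Vec ℤ (n ∸ 1)) : ℕ → Vec ℤ (n ∸ 1) → Set where
  base : Chain n c n c
  step : ∀ {k d e} → Chain n c (suc k) d → MinInc n k d e → Chain n c k e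

module Submission where

-- Let c′ be obtained from the minimal-cellular c by the chain of
-- minimal increases at the positions n-1, …, i+1.  Then c′ is a cubic coordinate
-- that agrees with c before position i and dominates c everywhere.  To show that
-- the entry c′ᵢ can be increased we exhibit one admissible larger value.
--   * If c′ᵢ < 0, raising it to 0 leaves u unchanged and only sets v_{i+1} to 0;
--     lowering entries of v to 0 preserves a Tamari interval diagram.
--   * If c′ᵢ = a ≥ 0, we raise it to a+1+u_{i+a+1}, i.e. the block at i swallows
--     the block starting at i+a+1.  This keeps a Tamari interval diagram as soon as
--     three block conditions hold: the block of length a+1 at i fits in [n], it is
--     nested in every earlier block covering i, and v_{i+a+1} < a+1.
--     All three hold for the coordinate c with cᵢ raised (minimal cellularity),
--     since there uᵢ ≥ a+1; they transfer to c′ because c′ agrees with c before i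
--     and has pointwise smaller v.

open import Defs
open import Data.Nat using (ℕ; suc; _≤_; _∸_)
open import Data.Integer using (ℤ)
open import Data.Vec using (Vec)

open import Data.Nat using (zero; _+_; _<_; _≟_; _≤?_; z≤n; s≤s)
open import Data.Nat.Properties
open import Data.Nat.Solver using (module +-*-Solver)
open import Data.Integer as ℤ using (+_; -[1+_]; 0ℤ; _⊔_; _⊓_; ∣_∣; -≤-; -≤+; +≤+; -<+; +<+)
import Data.Integer.Properties as ℤP
open import Data.Vec using ([]; _∷_)
open import Data.Product using (∃; _×_; _,_; proj₁; proj₂)
open import Data.Sum using (_⊎_; inj₁; inj₂)
open import Data.Empty using (⊥-elim)
open import Relation.Nullary using (yes; no)
open import Relation.Binary.PropositionalEquality

open +-*-Solver using (solve; _:+_; _:=_)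

within-or-beyond : ∀ a j → j ≤ a ⊎ ∃ λ t → j ≡ suc a + t
within-or-beyond a j with j ≤? a
... | yes j≤a = inj₁ j≤a
... | no  j≰a = inj₂ (j ∸ suc a , sym (m+[n∸m]≡n (≰⇒> j≰a)))

as-offset : ∀ {p q} → p < q → ∃ λ d → q ≡ p + suc d
as-offset {p} {q} p<q = q ∸ suc p , sym (trans (+-suc p (q ∸ suc p)) (m+[n∸m]≡n p<q))

offset-after : ∀ {k j i} → k + suc j ≡ i → k < i
offset-after {k} e = subst (k <_) e (m<m+n k (s≤s z≤n))

module _ {n : ℕ} {u : ℕ → ℕ} where

  tamari-bound : IsTamariDiagram n u → ∀ {k} → 1 ≤ k → k ≤ n → u k + k ≤ n
  tamari-bound T {k} 1≤k k≤n = m≤o∸n⇒m+n≤o (u k) k≤n (proj₁ (T k 1≤k k≤n))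

  tamari-step : IsTamariDiagram n u → ∀ {k j} → 1 ≤ k → k ≤ n → j ≤ u k →
                u (k + j) + j ≤ u k
  tamari-step T {k} {j} 1≤k k≤n j≤uk =
    m≤o∸n⇒m+n≤o (u (k + j)) j≤uk (proj₂ (T k 1≤k k≤n) j j≤uk)

  tamari-intro : (∀ k → 1 ≤ k → k ≤ n →
                   u k + k ≤ n × (∀ j → j ≤ u k → u (k + j) + j ≤ u k)) →
                 IsTamariDiagram n u
  tamari-intro h k 1≤k k≤n =
    m+n≤o⇒m≤o∸n (u k) (proj₁ (h k 1≤k k≤n)) ,
    λ j j≤uk → m+n≤o⇒m≤o∸n (u (k + j)) (proj₂ (h k 1≤k k≤n) j j≤uk)

Compatible : ℕ → (ℕ → ℕ) → (ℕ → ℕ) → Set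
Compatible n u v = ∀ i j → 1 ≤ i → i < j → j ≤ n → j ∸ i ≤ u i → v j < j ∸ i

CompatibleByOffset : ℕ → (ℕ → ℕ) → (ℕ → ℕ) → Set
CompatibleByOffset n u v =
  ∀ p d → 1 ≤ p → p + suc d ≤ n → suc d ≤ u p → v (p + suc d) < suc d

module _ {n : ℕ} {u v : ℕ → ℕ} where

  compatible⇒byOffset : Compatible n u v → CompatibleByOffset n u v
  compatible⇒byOffset X p d 1≤p fits d<up
    with X p (p + suc d) 1≤p (m<m+n p (s≤s z≤n)) fits
  ... | X′ rewrite m+n∸m≡n p (suc d) = X′ d<up

  byOffset⇒compatible : CompatibleByOffset n u v → Compatible n u v
  byOffset⇒compatible C p q 1≤p p<q q≤n with as-offset p<q
  ... | d , refl rewrite m+n∸m≡n p (suc d) = C p d 1≤p q≤n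

tid-cong : ∀ {n u v u′ v′} → (∀ k → u′ k ≡ u k) → (∀ k → v′ k ≡ v k) →
           IsTID n u v → IsTID n u′ v′
tid-cong {n} {u} {v} {u′} {v′} eu ev (T , D , X) = T′ , D′ , X′
  where
  T′ : IsTamariDiagram n u′
  T′ i 1≤i i≤n rewrite eu i =
    proj₁ (T i 1≤i i≤n) ,
    λ j j≤ → subst (_≤ u i ∸ j) (sym (eu (i + j))) (proj₂ (T i 1≤i i≤n) j j≤)
  D′ : IsDualTamariDiagram n v′
  D′ i 1≤i i≤n rewrite ev i =
    proj₁ (D i 1≤i i≤n) ,
    λ j j≤ → subst (_≤ v i ∸ j) (sym (ev (i ∸ j))) (proj₂ (D i 1≤i i≤n) j j≤)
  X′ : Compatible n u′ v′
  X′ i j 1≤i i<j j≤n le rewrite ev j =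
    X i j 1≤i i<j j≤n (subst (j ∸ i ≤_) (eu i) le)

tid-drop-dual : ∀ {n u v v′} → (∀ k → v′ k ≡ v k ⊎ v′ k ≡ 0) →
                IsTID n u v → IsTID n u v′
tid-drop-dual {n} {u} {v} {v′} h (T , D , X) = T , D′ , X′
  where
  v′≤v : ∀ k → v′ k ≤ v k
  v′≤v k with h k
  ... | inj₁ e = ≤-reflexive e
  ... | inj₂ e = subst (_≤ v k) (sym e) z≤n
  D′ : IsDualTamariDiagram n v′
  D′ i 1≤i i≤n = ≤-trans (v′≤v i) (proj₁ (D i 1≤i i≤n)) , below
    where
    below : ∀ j → j ≤ v′ i → v′ (i ∸ j) ≤ v′ i ∸ j
    below j j≤ with h i
    ... | inj₁ e rewrite e = ≤-trans (v′≤v (i ∸ j)) (proj₂ (D i 1≤i i≤n) j j≤)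
    ... | inj₂ e with subst (j ≤_) e j≤
    ...   | z≤n = ≤-refl
  X′ : Compatible n u v′
  X′ i j 1≤i i<j j≤n le = ≤-trans (s≤s (v′≤v j)) (X i j 1≤i i<j j≤n le)

-- The block [i, i+m] lies inside every earlier block of u that covers i.
Nested : (ℕ → ℕ) → ℕ → ℕ → Set
Nested u i m = ∀ k j → 1 ≤ k → k + suc j ≡ i → suc j ≤ u k → suc j + m ≤ u k

nested-cong : ∀ {u u′ i m} → (∀ k → k < i → u k ≡ u′ k) → Nested u i m → Nested u′ i m
nested-cong eq N k j 1≤k e le
  rewrite sym (eq k (offset-after e)) = N k j 1≤k e le

module BlockConstraints {n : ℕ} {u v : ℕ → ℕ} (tid : IsTID n u v)
  {i : ℕ} (1≤i : 1 ≤ i) (i≤n : i ≤ n) (a : ℕ) (a<ui : suc a ≤ u i) where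

  fits : i + suc a ≤ n
  fits = subst (_≤ n) (+-comm (suc a) i)
           (≤-trans (+-monoˡ-≤ i a<ui) (tamari-bound (proj₁ tid) 1≤i i≤n))

  nested : Nested u i (suc a)
  nested k j 1≤k e j<uk = subst (_≤ u k) (+-comm (suc a) (suc j))
    (≤-trans (+-monoˡ-≤ (suc j) (subst (suc a ≤_) (cong u (sym e)) a<ui))
             (tamari-step (proj₁ tid) 1≤k k≤n j<uk))
    where
    k≤n : k ≤ n
    k≤n = ≤-trans (<⇒≤ (offset-after e)) i≤n

  dual : v (i + suc a) < suc a
  dual = compatible⇒byOffset (proj₂ (proj₂ tid)) i a 1≤i fits a<ui

-- Conversely, if the three conditions hold for a block of length m = a+1 at i,
-- raising uᵢ = a to m + w with w = u_{i+m} (merging the two consecutive blocks)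
-- yields again a Tamari interval diagram with the same v.
module RaiseBlock {n : ℕ} {u u′ v : ℕ → ℕ} (tid : IsTID n u v)
  {i a : ℕ} (1≤i : 1 ≤ i) (fits : i + suc a ≤ n) (ui≡a : u i ≡ a)
  (u′i : u′ i ≡ suc a + u (i + suc a)) (u′k : ∀ k → k ≢ i → u′ k ≡ u k) where

  private
    m = suc a
    w = u (i + m)
    T = proj₁ tid
    i≤n : i ≤ n
    i≤n = ≤-trans (m≤m+n i m) fits
    1≤i+m : 1 ≤ i + m
    1≤i+m = ≤-trans 1≤i (m≤m+n i m)

    swap₃ : ∀ x y z → (x + y) + z ≡ y + (z + x)
    swap₃ = solve 3 (λ x y z → (x :+ y) :+ z := y :+ (z :+ x)) refl
    shift : ∀ x s t → x + t ≤ w → x + (s + t) ≤ s + w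
    shift x s t le = subst (_≤ s + w)
      (solve 3 (λ x s t → s :+ (x :+ t) := x :+ (s :+ t)) refl x s t)
      (+-monoʳ-≤ s le)

  raised-at-i : u′ i + i ≤ n × (∀ j → j ≤ u′ i → u′ (i + j) + j ≤ u′ i)
  raised-at-i rewrite u′i =
    subst (_≤ n) (sym (swap₃ m w i)) (tamari-bound T 1≤i+m fits) , below-i
    where
    below-i : ∀ j → j ≤ m + w → u′ (i + j) + j ≤ m + w
    below-i zero _ rewrite +-identityʳ i | u′i = ≤-reflexive (+-identityʳ (m + w))
    below-i (suc j) j<m+w rewrite u′k (i + suc j) (m+1+n≢m i) with within-or-beyond a (suc j)
    ... | inj₁ j≤a = ≤-trans
          (tamari-step T 1≤i i≤n (subst (suc j ≤_) (sym ui≡a) j≤a))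
          (subst (_≤ m + w) (sym ui≡a) (≤-trans (n≤1+n a) (m≤m+n m w)))
    ... | inj₂ (t , refl) rewrite sym (+-assoc i m t) =
          shift (u (i + m + t)) m t
            (tamari-step T 1≤i+m fits (+-cancelˡ-≤ m t w j<m+w))

  raised-elsewhere : Nested u i m → ∀ k → 1 ≤ k → k ≤ n → k ≢ i →
                     u′ k + k ≤ n × (∀ j → j ≤ u′ k → u′ (k + j) + j ≤ u′ k)
  raised-elsewhere N k 1≤k k≤n k≢i rewrite u′k k k≢i = tamari-bound T 1≤k k≤n , below-k
    where
    below-k : ∀ j → j ≤ u k → u′ (k + j) + j ≤ u k
    below-k zero _ rewrite +-identityʳ k | u′k k k≢i = ≤-reflexive (+-identityʳ (u k))
    below-k (suc j) j<uk with k + suc j ≟ i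
    ... | no ≢i rewrite u′k (k + suc j) ≢i = tamari-step T 1≤k k≤n j<uk
    ... | yes e rewrite e | u′i =
          subst (_≤ u k) (sym (swap₃ m w (suc j)))
            (subst (λ p → u p + (suc j + m) ≤ u k) reach
              (tamari-step T 1≤k k≤n (N k j 1≤k e j<uk)))
      where
      reach : k + (suc j + m) ≡ i + m
      reach = trans (sym (+-assoc k (suc j) m)) (cong (_+ m) e)

  raised-compatible : v (i + m) < m → Compatible n u′ v
  raised-compatible dual = byOffset⇒compatible C
    where
    C₀ = compatible⇒byOffset (proj₂ (proj₂ tid))
    C : CompatibleByOffset n u′ v
    C p d 1≤p fits′ d<u′p with p ≟ i
    ... | no p≢i = C₀ p d 1≤p fits′ (subst (suc d ≤_) (u′k p p≢i) d<u′p)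
    ... | yes refl with within-or-beyond a (suc d)
    ...   | inj₁ d<a = C₀ p d 1≤p fits′ (subst (suc d ≤_) (sym ui≡a) d<a)
    ...   | inj₂ (zero , refl) rewrite +-identityʳ a = dual
    ...   | inj₂ (suc t , refl) rewrite sym (+-assoc i m (suc t)) =
            ≤-trans (C₀ (i + m) t 1≤i+m fits′ t<w) (m≤n+m (suc t) m)
      where
      t<w : suc t ≤ w
      t<w = +-cancelˡ-≤ m (suc t) w (subst (m + suc t ≤_) u′i d<u′p)

  raised : Nested u i m → v (i + m) < m → IsTID n u′ v
  raised N dual = tamari-intro conditions , proj₁ (proj₂ tid) , raised-compatible dual
    where
    conditions : ∀ k → 1 ≤ k → k ≤ n →
         u′ k + k ≤ n × (∀ j → j ≤ u′ k → u′ (k + j) + j ≤ u′ k)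
    conditions k 1≤k k≤n with k ≟ i
    ... | yes refl = raised-at-i
    ... | no k≢i = raised-elsewhere N k 1≤k k≤n k≢i

posPart negPart : ℤ → ℕ
posPart z = ∣ z ⊔ 0ℤ ∣
negPart z = ∣ z ⊓ 0ℤ ∣

posPart-+ : ∀ a → posPart (+ a) ≡ a
posPart-+ a = ⊔-identityʳ a

negPart-+ : ∀ a → negPart (+ a) ≡ 0
negPart-+ a = ⊓-zeroʳ a

negPart-antitone : ∀ {x y} → x ℤ.≤ y → negPart y ≤ negPart x
negPart-antitone (-≤- le) = s≤s le
negPart-antitone {x} (-≤+ {n = b}) = subst (_≤ negPart x) (sym (negPart-+ b)) z≤n
negPart-antitone (+≤+ {a} {b} _) = subst₂ _≤_ (sym (negPart-+ b)) (sym (negPart-+ a)) z≤n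

posPart-above : ∀ {a z} → + a ℤ.< z → suc a ≤ posPart z
posPart-above {z = + b} (+<+ a<b) = subst (_ ≤_) (sym (posPart-+ b)) a<b

at-set-≢ : ∀ {m} (xs : Vec ℤ m) k j z → j ≢ k → at (set xs k z) j ≡ at xs j
at-set-≢ [] k j z _ = refl
at-set-≢ (x ∷ xs) zero j z _ = refl
at-set-≢ (x ∷ xs) (suc zero) zero z _ = refl
at-set-≢ (x ∷ xs) (suc zero) (suc zero) z ne = ⊥-elim (ne refl)
at-set-≢ (x ∷ xs) (suc zero) (suc (suc j)) z _ = refl
at-set-≢ (x ∷ xs) (suc (suc k)) zero z _ = refl
at-set-≢ (x ∷ xs) (suc (suc k)) (suc zero) z _ = refl
at-set-≢ (x ∷ xs) (suc (suc k)) (suc (suc j)) z ne =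
  at-set-≢ xs (suc k) (suc j) z (λ e → ne (cong suc e))

at-set-in : ∀ {m} (xs : Vec ℤ m) k z → 1 ≤ k → k ≤ m → at (set xs k z) k ≡ z
at-set-in (x ∷ xs) (suc zero) z _ _ = refl
at-set-in (x ∷ xs) (suc (suc k)) z _ (s≤s le) = at-set-in xs (suc k) z (s≤s z≤n) le

at-set-self : ∀ {m} (xs : Vec ℤ m) k z → at (set xs k z) k ≡ z ⊎ at (set xs k z) k ≡ at xs k
at-set-self [] k z = inj₂ refl
at-set-self (x ∷ xs) zero z = inj₂ refl
at-set-self (x ∷ xs) (suc zero) z = inj₁ refl
at-set-self (x ∷ xs) (suc (suc k)) z = at-set-self xs (suc k) z

module _ (n : ℕ) (c : Vec ℤ (n ∸ 1)) where

  uOf-set-≢ : ∀ {i k} z → k ≢ i → uOf n (set c i z) k ≡ uOf n c k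
  uOf-set-≢ {i} {k} z k≢i = cong posPart (at-set-≢ c i k z k≢i)

  uOf-set-in : ∀ {i} z → 1 ≤ i → i ≤ n ∸ 1 → uOf n (set c i z) i ≡ posPart z
  uOf-set-in {i} z 1≤i i≤ = cong posPart (at-set-in c i z 1≤i i≤)

  vOf-suc : ∀ {i} → 1 ≤ i → vOf n c (suc i) ≡ negPart (at c i)
  vOf-suc {suc i} _ = refl

  vOf-set-≢ : ∀ {i} q z → q ≢ suc i → vOf n (set c i z) q ≡ vOf n c q
  vOf-set-≢ zero z _ = refl
  vOf-set-≢ (suc zero) z _ = refl
  vOf-set-≢ {i} (suc (suc q)) z ne =
    cong negPart (at-set-≢ c i (suc q) z (λ e → ne (cong suc e)))

vOf-set-in : ∀ n (c : Vec ℤ (n ∸ 1)) {i} z → 1 ≤ i → i ≤ n ∸ 1 →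
             vOf n (set c i z) (suc i) ≡ negPart z
vOf-set-in n c {i} z 1≤i i≤ = trans (vOf-suc n (set c i z) 1≤i) (cong negPart (at-set-in c i z 1≤i i≤))

vOf-antitone : ∀ n {c d : Vec ℤ (n ∸ 1)} → (∀ j → at c j ℤ.≤ at d j) →
               ∀ q → vOf n d q ≤ vOf n c q
vOf-antitone n c≤d zero = z≤n
vOf-antitone n c≤d (suc zero) = z≤n
vOf-antitone n c≤d (suc (suc q)) = negPart-antitone (c≤d (suc q))

record Reached (n : ℕ) (c : Vec ℤ (n ∸ 1)) (k : ℕ) (d : Vec ℤ (n ∸ 1)) : Set where
  field
    isCC    : IsCC n d
    agrees  : ∀ j → j < k → at d j ≡ at c j
    above   : ∀ j → at c j ℤ.≤ at d j

open Reached

reached : ∀ {n c k d} → IsCC n c → Chain n c k d → Reached n c k d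
reached cc base = record { isCC = cc ; agrees = λ _ _ → refl ; above = λ _ → ℤP.≤-refl }
reached {n} {c} {k} cc (step {d = d} ch (z , d<z , ccz , _ , refl)) = record
  { isCC = ccz ; agrees = agrees′ ; above = above′ }
  where
  r = reached cc ch
  agrees′ : ∀ j → j < k → at (set d k z) j ≡ at c j
  agrees′ j j<k = trans (at-set-≢ d k j z (<⇒≢ j<k)) (agrees r j (m≤n⇒m≤1+n j<k))
  above′ : ∀ j → at c j ℤ.≤ at (set d k z) j
  above′ j with j ≟ k
  ... | no j≢k rewrite at-set-≢ d k j z j≢k = above r j
  ... | yes refl with at-set-self d j z
  ...   | inj₁ e rewrite e = ℤP.≤-trans (above r j) (ℤP.<⇒≤ d<z)
  ...   | inj₂ e rewrite e = above r j

-- A negative entry can be raised to 0: u is unchanged and v loses its (i+1)-th entry.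
raise-negative : ∀ {n} {c : Vec ℤ (n ∸ 1)} {i x} → IsCC n c → 1 ≤ i → i ≤ n ∸ 1 →
                 at c i ≡ -[1+ x ] → UpDefined n i c
raise-negative {n} {c} {i} cc 1≤i i≤ ci≡ =
  0ℤ , subst (ℤ._< 0ℤ) (sym ci≡) -<+ ,
  tid-drop-dual v-dropped (tid-cong u-same (λ _ → refl) cc)
  where
  u-same : ∀ k → uOf n (set c i 0ℤ) k ≡ uOf n c k
  u-same k with k ≟ i
  ... | yes refl = trans (uOf-set-in n c 0ℤ 1≤i i≤) (cong posPart (sym ci≡))
  ... | no k≢i = uOf-set-≢ n c 0ℤ k≢i
  v-dropped : ∀ q → vOf n (set c i 0ℤ) q ≡ vOf n c q ⊎ vOf n (set c i 0ℤ) q ≡ 0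
  v-dropped q with q ≟ suc i
  ... | yes refl = inj₂ (vOf-set-in n c 0ℤ 1≤i i≤)
  ... | no q≢ = inj₁ (vOf-set-≢ n c q 0ℤ q≢)

raise-nonnegative : ∀ {n} {c : Vec ℤ (n ∸ 1)} {i a} → IsCC n c → 1 ≤ i → i ≤ n ∸ 1 →
  at c i ≡ + a → i + suc a ≤ n → Nested (uOf n c) i (suc a) →
  vOf n c (i + suc a) < suc a → UpDefined n i c
raise-nonnegative {n} {c} {i} {a} cc 1≤i i≤ ci≡ fits N dual =
  z , subst (ℤ._< z) (sym ci≡) (+<+ (s≤s (m≤m+n a w))) ,
  tid-cong (λ _ → refl) v-same
    (RaiseBlock.raised cc 1≤i fits u-at-i u-raised (λ k → uOf-set-≢ n c z) N dual)
  where
  w = uOf n c (i + suc a)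
  z = + (suc a + w)
  u-at-i : uOf n c i ≡ a
  u-at-i = trans (cong posPart ci≡) (posPart-+ a)
  u-raised : uOf n (set c i z) i ≡ suc a + w
  u-raised = trans (uOf-set-in n c z 1≤i i≤) (posPart-+ (suc a + w))
  v-same : ∀ q → vOf n (set c i z) q ≡ vOf n c q
  v-same q with q ≟ suc i
  ... | yes refl = begin
      vOf n (set c i z) (suc i) ≡⟨ trans (vOf-set-in n c z 1≤i i≤) (negPart-+ (suc a + w)) ⟩
      0                         ≡⟨ sym (negPart-+ a) ⟩
      negPart (+ a)             ≡⟨ cong negPart (sym ci≡) ⟩
      negPart (at c i)          ≡⟨ sym (vOf-suc n c 1≤i) ⟩
      vOf n c (suc i)           ∎
    where open ≡-Reasoning
  ... | no q≢ = vOf-set-≢ n c q z q≢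

-- After the chain, a non-negative entry of c′ satisfies the block conditions:
-- they hold for the coordinate c with cᵢ increased, and transfer to c′.
block-conditions : ∀ {n} {c c′ : Vec ℤ (n ∸ 1)} {i a} → IsMinCellular n c →
  1 ≤ i → i ≤ n ∸ 1 → Reached n c (suc i) c′ → at c′ i ≡ + a →
  i + suc a ≤ n × Nested (uOf n c′) i (suc a) × vOf n c′ (i + suc a) < suc a
block-conditions {n} {c} {c′} {i} {a} mc 1≤i i≤ r c′i≡ =
  fits , nested-cong u-before nested , ≤-trans (s≤s (v-below (i + suc a))) dual
  where
  z = proj₁ (mc i 1≤i i≤)
  c0 = set c i z
  ci≡ : at c i ≡ + a
  ci≡ = trans (sym (agrees r i ≤-refl)) c′i≡
  a<u0i : suc a ≤ uOf n c0 i
  a<u0i = subst (suc a ≤_) (sym (uOf-set-in n c z 1≤i i≤))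
            (posPart-above (subst (ℤ._< z) ci≡ (proj₁ (proj₂ (mc i 1≤i i≤)))))
  open BlockConstraints (proj₂ (proj₂ (mc i 1≤i i≤))) 1≤i (≤-trans i≤ (m∸n≤m n 1)) a a<u0i
  u-before : ∀ k → k < i → uOf n c0 k ≡ uOf n c′ k
  u-before k k<i = trans (uOf-set-≢ n c z (<⇒≢ k<i))
                         (cong posPart (sym (agrees r k (m≤n⇒m≤1+n k<i))))
  v-below : ∀ q → vOf n c′ q ≤ vOf n c0 q
  v-below q with q ≟ suc i
  ... | yes refl = subst (_≤ _) (sym (trans (vOf-suc n c′ 1≤i)
                     (trans (cong negPart c′i≡) (negPart-+ a)))) z≤n
  ... | no q≢ = subst (vOf n c′ q ≤_) (sym (vOf-set-≢ n c q z q≢)) (vOf-antitone n (above r) q)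

mainTheorem8 : ∀ n → 2 ≤ n → (c : Vec ℤ (n ∸ 1)) → IsCC n c → IsMinCellular n c →
    ∀ i → 1 ≤ i → i ≤ n ∸ 1 → ∀ c′ → Chain n c (suc i) c′ → UpDefined n i c′
mainTheorem8 n _ c cc mc i 1≤i i≤ c′ ch = raise-by-sign (at c′ i) refl
  where
  r = reached cc ch
  raise-by-sign : ∀ z → at c′ i ≡ z → UpDefined n i c′
  raise-by-sign -[1+ x ] c′i≡ = raise-negative (isCC r) 1≤i i≤ c′i≡
  raise-by-sign (+ a) c′i≡ with block-conditions mc 1≤i i≤ r c′i≡
  ... | fits , nested , dual = raise-nonnegative (isCC r) 1≤i i≤ c′i≡ fits nested dual
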